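{- Let $q$ be a power of an odd prime, let $A,B\in\mathbb{F}_q^*$, and let $$F_{A,B}(X,Y)=2AB(X^3+Y^3+1)+(2A^2B+4B^2)(X+Y^2+X^2Y)+(4AB^2+2B)(X^2+Y+XY^2)+(2A^3+8B^3+2)XY.$$ Let $\mathcal{C}_{A,B}$ be the plane curve defined by $F_{A,B}(X,Y)=0$. If $\mathcal{C}_{A,B}$ has a line of the form $Y-aX-b=0$ (with $a,b$ in an algebraic closure of $\mathbb{F}_q$) as a component, then one of the following holds: (1) $A-2B+1=0$ or $(A,B)\in\{(1,1),(1,-1/2)\}$; (2) $A^3-2AB+1=0$ and $A^3+1\neq 0$; (3) $A^2+A+1=0$, $B\in\{A^2,-A^2/2\}$, and $-3$ is a square in $\mathbb{F}_q$; (4) $A=B^2$; (5) $A^2+2AB-A+4B^2+2B+1=0$ and $-3$ is a square in $\mathbb{F}_q$.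
   Context: A curve has a line $\ell$ as a component if the linear polynomial defining $\ell$ divides the defining polynomial of the curve (over the algebraic closure). -}

module Defs where

open import Level using (Level; _⊔_) renaming (suc to lsuc)
open import Data.Nat as ℕ using (ℕ; zero; suc)
open import Data.Nat.Primality using (Prime)
open import Data.Nat.Divisibility using (_∣_)
open import Data.Fin using (Fin)
open import Data.List using (List; []; _∷_; length; map)
open import Data.Product using (Σ; ∃; ∃-syntax; _×_; _,_)
open import Data.Sum using (_⊎_)
open import Relation.Nullary using (¬_)
open import Algebra.Bundles using (CommutativeRing)
open import Algebra.Morphism.Structures using (module RingMorphisms)

record Field (c ℓ : Level) : Set (lsuc (c ⊔ ℓ)) where
  field
    commutativeRing : CommutativeRing c ℓ
  open CommutativeRing commutativeRing public
  field
    1≉0     : ¬ (1# ≈ 0#)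
    inverse : ∀ x → ¬ (x ≈ 0#) → ∃[ y ] (x * y ≈ 1#)

module FieldOps {c ℓ} (K : Field c ℓ) where
  open Field K

  _^_ : Carrier → ℕ → Carrier
  x ^ zero  = 1#
  x ^ suc n = x * (x ^ n)

  fromℕ : ℕ → Carrier
  fromℕ zero    = 0#
  fromℕ (suc n) = 1# + fromℕ n

  -- evaluation of the monic polynomial  x^n + c_{n-1} x^{n-1} + ... + c_0
  -- where cs = c_0 ∷ c_1 ∷ ... ∷ c_{n-1}  (n = length cs)
  evalMonic : List Carrier → Carrier → Carrier
  evalMonic []       x = 1#
  evalMonic (c ∷ cs) x = c + x * evalMonic cs x

  IsSquare : Carrier → Set (c ⊔ ℓ)
  IsSquare y = ∃[ x ] (x * x ≈ y)

HasCardinality : ∀ {c ℓ} → Field c ℓ → ℕ → Set (c ⊔ ℓ)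
HasCardinality K q =
  Σ (Fin q → Carrier) λ f →
    (∀ i j → f i ≈ f j → i ≡ j) × (∀ y → ∃[ i ] (f i ≈ y))
  where open Field K
        open import Relation.Binary.PropositionalEquality using (_≡_)

IsPowerOfOddPrime : ℕ → Set
IsPowerOfOddPrime q =
  ∃[ p ] ∃[ n ] (Prime p × ¬ (2 ∣ p) × 1 ℕ.≤ n × q ≡ p ℕ.^ n)
  where open import Relation.Binary.PropositionalEquality using (_≡_)

IsAlgebraicallyClosed : ∀ {c ℓ} → Field c ℓ → Set (c ⊔ ℓ)
IsAlgebraicallyClosed K =
  ∀ (cs : List Carrier) → 1 ℕ.≤ length cs → ∃[ x ] (evalMonic cs x ≈ 0#)
  where open Field K
        open FieldOps K

record IsAlgebraicClosure {c ℓ c′ ℓ′} (K : Field c ℓ) (L : Field c′ ℓ′)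
         (ι : Field.Carrier K → Field.Carrier L) : Set (c ⊔ ℓ ⊔ c′ ⊔ ℓ′) where
  open RingMorphisms (Field.rawRing K) (Field.rawRing L)
  open Field L
  open FieldOps L
  field
    isRingHomomorphism : IsRingHomomorphism ι
    algClosed          : IsAlgebraicallyClosed L
    algebraic          : ∀ (x : Carrier) →
                           ∃[ cs ] (evalMonic (map ι cs) x ≈ 0#)

-- Bivariate polynomials as coefficient functions ℕ → ℕ → K, where
-- P i j is the coefficient of X^i Y^j.

module Bivariate {c ℓ} (K : Field c ℓ) where
  open Field K
  open import Data.Nat using (_<_) renaming (_+_ to _+ℕ_)

  Poly : Set c
  Poly = ℕ → ℕ → Carrier

  IsPolynomial : Poly → Set ℓ
  IsPolynomial P = ∃[ N ] (∀ i j → N < i +ℕ j → P i j ≈ 0#)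

  shiftY : Poly → Poly
  shiftY P i zero    = 0#
  shiftY P i (suc j) = P i j

  shiftX : Poly → Poly
  shiftX P zero    j = 0#
  shiftX P (suc i) j = P i j

  -- the product (Y - a X - b) * G
  lineTimes : Carrier → Carrier → Poly → Poly
  lineTimes a b G i j = (shiftY G i j - a * shiftX G i j) - b * G i j

  LineDivides : Carrier → Carrier → Poly → Set (c ⊔ ℓ)
  LineDivides a b P =
    ∃[ G ] (IsPolynomial G × (∀ i j → P i j ≈ lineTimes a b G i j))

module CurveF {c ℓ} (K : Field c ℓ) where
  open Field K
  open FieldOps K

  c₀ c₁ c₂ c₃ : Carrier → Carrier → Carrier
  c₀ A B = fromℕ 2 * A * B
  c₁ A B = fromℕ 2 * (A ^ 2) * B + fromℕ 4 * (B ^ 2)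
  c₂ A B = fromℕ 4 * A * (B ^ 2) + fromℕ 2 * B
  c₃ A B = fromℕ 2 * (A ^ 3) + fromℕ 8 * (B ^ 3) + fromℕ 2

  F : Carrier → Carrier → ℕ → ℕ → Carrier
  F A B 3 0 = c₀ A B
  F A B 0 3 = c₀ A B
  F A B 0 0 = c₀ A B
  F A B 1 0 = c₁ A B
  F A B 0 2 = c₁ A B
  F A B 2 1 = c₁ A B
  F A B 2 0 = c₂ A B
  F A B 0 1 = c₂ A B
  F A B 1 2 = c₂ A B
  F A B 1 1 = c₃ A B
  F A B _ _ = 0#

module Conclusion {c ℓ} (K : Field c ℓ) where
  open Field K
  open FieldOps K

  Concl : Carrier → Carrier → Set (c ⊔ ℓ)
  Concl A B =
    ((A - fromℕ 2 * B + 1# ≈ 0#)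
       ⊎ (A ≈ 1# × B ≈ 1#)
       ⊎ (A ≈ 1# × fromℕ 2 * B ≈ - 1#))
    ⊎ ((A ^ 3 - fromℕ 2 * A * B + 1# ≈ 0#) × ¬ (A ^ 3 + 1# ≈ 0#))
    ⊎ ((A ^ 2 + A + 1# ≈ 0#)
         × ((B ≈ A ^ 2) ⊎ (fromℕ 2 * B ≈ - (A ^ 2)))
         × IsSquare (- fromℕ 3))
    ⊎ (A ≈ B ^ 2)
    ⊎ ((A ^ 2 + fromℕ 2 * A * B - A + fromℕ 4 * (B ^ 2) + fromℕ 2 * B + 1# ≈ 0#)
         × IsSquare (- fromℕ 3))

module Submission where

-- F_{A,B} is the member C = c(A,B) of the family of symmetric cubics
--   F_C = C₀(X³ + Y³ + 1) + C₁(X + Y² + X²Y) + C₂(X² + Y + XY²) + C₃XY.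
-- The proof has four steps.
--  (a) If Y - aX - b divides a cubic P, the quotient has degree ≤ 2, so the
--      four coefficients of P(X, aX + b) vanish (LinesOnCubics).
--  (b) For F_C with C₀ ≠ 0 these equations force the line criterion: Ψ(C) = 0,
--      or X₁(C) = X₂(C) = 0, or W₁(C) = W₂(C) = 0 (SymmetricCubic).  If ab ≠ 1,
--      elimination shows that C is proportional to a vector n(a,b) on which Ψ
--      vanishes; if ab = 1 and b³ ≠ -1, the line Y = -b²X + b also lies on F_C
--      and has slope·intercept ≠ 1; b = -1 and b² - b + 1 = 0 give the X- and
--      W-conditions.  This case split is classical, so (b) is double-negated.
--  (c) The criterion is given by integer polynomials, so it descends from L to
--      K along ι; in the finite field K it is decidable, which removes the
--      double negation (FieldHomomorphism, FiniteField).
--  (d) For C = c(A,B) the three conditions factor, and since 2, A, B ≠ 0 (2 ≠ 0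
--      because q is odd) the factors yield exactly (1)-(5) (TheFamily).

open import Defs
open import Level using (Level)
open import Algebra.Bundles using (CommutativeRing)
open import Algebra.Morphism.Structures using (module RingMorphisms)
open import Data.Nat as ℕ using (ℕ; zero; suc; s≤s; _<_) renaming (_+_ to _+ℕ_)
open import Relation.Nullary using (¬_; Dec; yes; no)
open import Relation.Nullary.Decidable using (decidable-stable)
open import Relation.Nullary.Negation using (¬¬-map)
open import Relation.Binary.PropositionalEquality as ≡ using (_≡_)

-- Every
-- polynomial of the proof is defined once over RingOps: at a ring it is an
-- element, at solver syntax it is an expression the ring solver can check.
-- fromℕ and _^_ have exactly the shape of those in FieldOps, so both readings
-- agree definitionally with the statement.
record RingOps {t} (T : Set t) : Set t where
  infixl 6 _+_ _-_
  infixl 7 _*_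
  infix  8 -_
  field
    0# 1#   : T
    _+_ _*_ : T → T → T
    -_      : T → T

  _-_ : T → T → T
  x - y = x + - y

  fromℕ : ℕ → T
  fromℕ zero    = 0#
  fromℕ (suc n) = 1# + fromℕ n

  _^_ : T → ℕ → T
  x ^ zero  = 1#
  x ^ suc n = x * (x ^ n)

ringOps : ∀ {c ℓ} (R : CommutativeRing c ℓ) → RingOps (CommutativeRing.Carrier R)
ringOps R = record { 0# = 0# ; 1# = 1# ; _+_ = _+_ ; _*_ = _*_ ; -_ = -_ }
  where open CommutativeRing R

module Curve {t} {T : Set t} (O : RingOps T) where
  open RingOps O

  c₀ c₁ c₂ c₃ : T → T → T
  c₀ A B = fromℕ 2 * A * B
  c₁ A B = fromℕ 2 * (A ^ 2) * B + fromℕ 4 * (B ^ 2)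
  c₂ A B = fromℕ 4 * A * (B ^ 2) + fromℕ 2 * B
  c₃ A B = fromℕ 2 * (A ^ 3) + fromℕ 8 * (B ^ 3) + fromℕ 2

  symmetricCubic : T → T → T → T → ℕ → ℕ → T
  symmetricCubic C₀ C₁ C₂ C₃ 3 0 = C₀
  symmetricCubic C₀ C₁ C₂ C₃ 0 3 = C₀
  symmetricCubic C₀ C₁ C₂ C₃ 0 0 = C₀
  symmetricCubic C₀ C₁ C₂ C₃ 1 0 = C₁
  symmetricCubic C₀ C₁ C₂ C₃ 0 2 = C₁
  symmetricCubic C₀ C₁ C₂ C₃ 2 1 = C₁
  symmetricCubic C₀ C₁ C₂ C₃ 2 0 = C₂
  symmetricCubic C₀ C₁ C₂ C₃ 0 1 = C₂
  symmetricCubic C₀ C₁ C₂ C₃ 1 2 = C₂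
  symmetricCubic C₀ C₁ C₂ C₃ 1 1 = C₃
  symmetricCubic C₀ C₁ C₂ C₃ _ _ = 0#

  -- For a cubic p (coefficient family), restrictionₖ p a b is the coefficient
  -- of X^k in p(X, aX + b).
  restriction₃ restriction₂ restriction₁ restriction₀ : (ℕ → ℕ → T) → T → T → T
  restriction₃ p a b = p 3 0 + p 2 1 * a + p 1 2 * a ^ 2 + p 0 3 * a ^ 3
  restriction₂ p a b = p 2 0 + p 1 1 * a + p 0 2 * a ^ 2 + p 2 1 * b
                       + fromℕ 2 * p 1 2 * a * b + fromℕ 3 * p 0 3 * a ^ 2 * b
  restriction₁ p a b = p 1 0 + p 0 1 * a + p 1 1 * b + fromℕ 2 * p 0 2 * a * b
                       + p 1 2 * b ^ 2 + fromℕ 3 * p 0 3 * a * b ^ 2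
  restriction₀ p a b = p 0 0 + p 0 1 * b + p 0 2 * b ^ 2 + p 0 3 * b ^ 3

  cubic : (g₀₀ g₁₀ g₀₁ g₂₀ g₁₁ g₀₂ g₃₀ g₂₁ g₁₂ g₀₃ : T) → ℕ → ℕ → T
  cubic g₀₀ g₁₀ g₀₁ g₂₀ g₁₁ g₀₂ g₃₀ g₂₁ g₁₂ g₀₃ = λ where
    0 0 → g₀₀ ; 1 0 → g₁₀ ; 0 1 → g₀₁ ; 2 0 → g₂₀ ; 1 1 → g₁₁
    0 2 → g₀₂ ; 3 0 → g₃₀ ; 2 1 → g₂₁ ; 1 2 → g₁₂ ; 0 3 → g₀₃ ; _ _ → 0#

  lineProduct : T → T → (ℕ → ℕ → T) → ℕ → ℕ → T
  lineProduct a b g i j = (shiftY i j - a * shiftX i j) - b * g i j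
    where
    shiftY shiftX : ℕ → ℕ → T
    shiftY i zero    = 0#
    shiftY i (suc j) = g i j
    shiftX zero    j = 0#
    shiftX (suc i) j = g i j

  E₃ E₂ E₁ E₀ : T → T → T → T → T → T → T
  E₃ C₀ C₁ C₂ C₃ = restriction₃ (symmetricCubic C₀ C₁ C₂ C₃)
  E₂ C₀ C₁ C₂ C₃ = restriction₂ (symmetricCubic C₀ C₁ C₂ C₃)
  E₁ C₀ C₁ C₂ C₃ = restriction₁ (symmetricCubic C₀ C₁ C₂ C₃)
  E₀ C₀ C₁ C₂ C₃ = restriction₀ (symmetricCubic C₀ C₁ C₂ C₃)

  -- For a line Y = aX + b with ab ≠ 1 on F_C, C is proportional to n(a, b).
  n₀ n₁ n₂ n₃ : T → T → T
  n₀ a b = - (a * b)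
  n₁ a b = b + a * b ^ 2 - a ^ 2
  n₂ a b = a + a ^ 2 * b - b ^ 2
  n₃ a b = a ^ 3 + b ^ 3 - fromℕ 3 * a * b - 1#

  Q₅ : T → T → T
  Q₅ A B = A ^ 2 + fromℕ 2 * A * B - A + fromℕ 4 * (B ^ 2) + fromℕ 2 * B + 1#

  Ψ X₁ X₂ W₁ W₂ : T → T → T → T → T
  Ψ C₀ C₁ C₂ C₃ = fromℕ 9 * C₀ ^ 3 - fromℕ 3 * C₀ ^ 2 * C₃ + C₀ * C₃ ^ 2
                  - fromℕ 3 * C₀ * C₁ * C₂ - C₁ * C₂ * C₃ + C₁ ^ 3 + C₂ ^ 3
  X₁ C₀ C₁ C₂ C₃ = C₂ - C₁
  X₂ C₀ C₁ C₂ C₃ = fromℕ 3 * C₂ - fromℕ 3 * C₀ - C₃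
  W₁ C₀ C₁ C₂ C₃ = C₁ ^ 2 + C₁ * C₂ + C₂ ^ 2
  W₂ C₀ C₁ C₂ C₃ = C₂ * (fromℕ 3 * C₀ + fromℕ 3 * C₁ + fromℕ 3 * C₂ + C₃)

-- The ring solver of the standard library for an arbitrary commutative ring R,
-- with integer coefficients; it needs the canonical ring map ℤ → R.
module IntegerSolver {c ℓ} (R : CommutativeRing c ℓ) where
  open import Data.Integer as ℤ using (ℤ; +_; -[1+_]; _⊖_; _◃_; sign; ∣_∣)
  import Data.Integer.Properties as ℤ
  open import Data.Sign as Sign using (Sign)
  open import Data.Maybe using (Maybe; just; nothing)
  import Algebra.Solver.Ring.AlmostCommutativeRing as ACR
  open CommutativeRing R
  open import Algebra.Properties.Ring ring using (-0#≈0#; -‿distribˡ-*; -‿distribʳ-*; -‿involutive; -‿+-comm)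
  open import Algebra.Properties.Semiring.Mult.TCOptimised semiring using (_×_; ×-homo-+; ×1-homo-*)
  open import Relation.Binary.Reasoning.Setoid setoid

  ⟦_⟧ℕ : ℕ → Carrier
  ⟦ n ⟧ℕ = n × 1#

  ⟦_⟧ℤ : ℤ → Carrier
  ⟦ + n ⟧ℤ      = ⟦ n ⟧ℕ
  ⟦ -[1+ n ] ⟧ℤ = - ⟦ suc n ⟧ℕ

  ⟦suc⟧ : ∀ n → ⟦ suc n ⟧ℕ ≈ 1# + ⟦ n ⟧ℕ
  ⟦suc⟧ n = ×-homo-+ 1# 1 n

  ⊖-homo : ∀ m n → ⟦ m ⊖ n ⟧ℤ ≈ ⟦ m ⟧ℕ - ⟦ n ⟧ℕ
  ⊖-homo m zero = begin
    ⟦ m ⊖ 0 ⟧ℤ    ≡⟨ ≡.cong ⟦_⟧ℤ (ℤ.⊖-≥ {m} ℕ.z≤n) ⟩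
    ⟦ m ⟧ℕ        ≈⟨ +-identityʳ _ ⟨
    ⟦ m ⟧ℕ + 0#   ≈⟨ +-congˡ -0#≈0# ⟨
    ⟦ m ⟧ℕ - 0#   ∎
  ⊖-homo zero (suc n) = sym (+-identityˡ _)
  ⊖-homo (suc m) (suc n) = begin
    ⟦ suc m ⊖ suc n ⟧ℤ            ≡⟨ ≡.cong ⟦_⟧ℤ (ℤ.[1+m]⊖[1+n]≡m⊖n m n) ⟩
    ⟦ m ⊖ n ⟧ℤ                    ≈⟨ ⊖-homo m n ⟩
    ⟦ m ⟧ℕ - ⟦ n ⟧ℕ                ≈⟨ cancel-1 ⟨
    (1# + ⟦ m ⟧ℕ) - (1# + ⟦ n ⟧ℕ)  ≈⟨ +-cong (⟦suc⟧ m) (-‿cong (⟦suc⟧ n)) ⟨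
    ⟦ suc m ⟧ℕ - ⟦ suc n ⟧ℕ        ∎
    where
    cancel-1 : ∀ {x y} → (1# + x) - (1# + y) ≈ x - y
    cancel-1 {x} {y} = begin
      (1# + x) - (1# + y)      ≈⟨ +-congˡ (-‿+-comm 1# y) ⟨
      (1# + x) + (- 1# - y)    ≈⟨ +-assoc 1# x _ ⟩
      1# + (x + (- 1# - y))    ≈⟨ +-congˡ (+-congˡ (+-comm _ _)) ⟩
      1# + (x + (- y + - 1#))  ≈⟨ +-congˡ (+-assoc x _ _) ⟨
      1# + ((x - y) + - 1#)    ≈⟨ +-congˡ (+-comm _ _) ⟩
      1# + (- 1# + (x - y))    ≈⟨ +-assoc 1# _ _ ⟨
      (1# - 1#) + (x - y)      ≈⟨ +-congʳ (-‿inverseʳ 1#) ⟩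
      0# + (x - y)             ≈⟨ +-identityˡ _ ⟩
      x - y                    ∎

  +-homo : ∀ i j → ⟦ i ℤ.+ j ⟧ℤ ≈ ⟦ i ⟧ℤ + ⟦ j ⟧ℤ
  +-homo (+ m)    (+ n)    = ×-homo-+ 1# m n
  +-homo (+ m)    -[1+ n ] = ⊖-homo m (suc n)
  +-homo -[1+ m ] (+ n)    = trans (⊖-homo n (suc m)) (+-comm _ _)
  +-homo -[1+ m ] -[1+ n ] = begin
    - ⟦ suc (suc (m ℕ.+ n)) ⟧ℕ    ≡⟨ ≡.cong (λ k → - ⟦ suc k ⟧ℕ) (ℕₚ.+-suc m n) ⟨
    - ⟦ suc m ℕ.+ suc n ⟧ℕ        ≈⟨ -‿cong (×-homo-+ 1# (suc m) (suc n)) ⟩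
    - (⟦ suc m ⟧ℕ + ⟦ suc n ⟧ℕ)    ≈⟨ -‿+-comm _ _ ⟨
    - ⟦ suc m ⟧ℕ - ⟦ suc n ⟧ℕ      ∎
    where import Data.Nat.Properties as ℕₚ

  -- Multiplication is handled through the sign/absolute-value decomposition.
  signed : Sign → Carrier → Carrier
  signed Sign.+ x = x
  signed Sign.- x = - x

  signed-cong : ∀ s {x y} → x ≈ y → signed s x ≈ signed s y
  signed-cong Sign.+ p = p
  signed-cong Sign.- p = -‿cong p

  ◃-homo : ∀ s n → ⟦ s ◃ n ⟧ℤ ≈ signed s ⟦ n ⟧ℕ
  ◃-homo Sign.+ zero    = refl
  ◃-homo Sign.- zero    = sym -0#≈0#
  ◃-homo Sign.+ (suc n) = refl
  ◃-homo Sign.- (suc n) = refl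

  sign-abs : ∀ i → ⟦ i ⟧ℤ ≈ signed (sign i) ⟦ ∣ i ∣ ⟧ℕ
  sign-abs (+ n)    = refl
  sign-abs -[1+ n ] = refl

  signed-* : ∀ s t x y → signed (s Sign.* t) (x * y) ≈ signed s x * signed t y
  signed-* Sign.+ Sign.+ x y = refl
  signed-* Sign.+ Sign.- x y = -‿distribʳ-* x y
  signed-* Sign.- Sign.+ x y = -‿distribˡ-* x y
  signed-* Sign.- Sign.- x y = begin
    x * y          ≈⟨ -‿involutive _ ⟨
    - - (x * y)    ≈⟨ -‿cong (-‿distribˡ-* x y) ⟩
    - (- x * y)    ≈⟨ -‿distribʳ-* (- x) y ⟩
    - x * - y      ∎

  *-homo : ∀ i j → ⟦ i ℤ.* j ⟧ℤ ≈ ⟦ i ⟧ℤ * ⟦ j ⟧ℤ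
  *-homo i j = begin
    ⟦ s ◃ (∣ i ∣ ℕ.* ∣ j ∣) ⟧ℤ                      ≈⟨ ◃-homo s (∣ i ∣ ℕ.* ∣ j ∣) ⟩
    signed s ⟦ ∣ i ∣ ℕ.* ∣ j ∣ ⟧ℕ                    ≈⟨ signed-cong s (×1-homo-* ∣ i ∣ ∣ j ∣) ⟩
    signed s (⟦ ∣ i ∣ ⟧ℕ * ⟦ ∣ j ∣ ⟧ℕ)                ≈⟨ signed-* (sign i) (sign j) _ _ ⟩
    signed (sign i) ⟦ ∣ i ∣ ⟧ℕ * signed (sign j) ⟦ ∣ j ∣ ⟧ℕ ≈⟨ *-cong (sign-abs i) (sign-abs j) ⟨
    ⟦ i ⟧ℤ * ⟦ j ⟧ℤ                                 ∎
    where
    s : Sign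
    s = sign i Sign.* sign j

  neg-homo : ∀ i → ⟦ ℤ.- i ⟧ℤ ≈ - ⟦ i ⟧ℤ
  neg-homo (+ zero)  = sym -0#≈0#
  neg-homo (+ suc n) = refl
  neg-homo -[1+ n ]  = sym (-‿involutive _)

  ℤ-morphism : ℤ.+-*-rawRing ACR.-Raw-AlmostCommutative⟶ ACR.fromCommutativeRing R
  ℤ-morphism = record
    { ⟦_⟧    = ⟦_⟧ℤ
    ; +-homo = +-homo
    ; *-homo = *-homo
    ; -‿homo = neg-homo
    ; 0-homo = refl
    ; 1-homo = refl
    }

  -- Equal integer coefficients have equal images (all the solver needs).
  ℤ-coefficients≟ : ∀ i j → Maybe (⟦ i ⟧ℤ ≈ ⟦ j ⟧ℤ)
  ℤ-coefficients≟ i j with i ℤ.≟ j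
  ... | yes ≡.refl = just refl
  ... | no _       = nothing

  open import Algebra.Solver.Ring ℤ.+-*-rawRing (ACR.fromCommutativeRing R) ℤ-morphism ℤ-coefficients≟ public
    using (Polynomial; con; _:+_; _:*_; :-_; _:-_; _:^_; solve; _:=_)

  syntaxOps : ∀ {n} → RingOps (Polynomial n)
  syntaxOps = record { 0# = con (+ 0) ; 1# = con (+ 1) ; _+_ = _:+_ ; _*_ = _:*_ ; -_ = :-_ }

  κ : ∀ {n} → ℕ → Polynomial n
  κ = RingOps.fromℕ syntaxOps

  -- The constants 0# and 1# themselves (κ 1 is 1# + 0#).
  𝟎 𝟏 : ∀ {n} → Polynomial n
  𝟎 = con (+ 0)
  𝟏 = con (+ 1)

  module S {n} = Curve (syntaxOps {n})


-- Ring expressions, used to transport polynomial identities along ring maps.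
module Expressions where
  open import Data.Fin as Fin using (Fin)
  open import Data.Vec using (Vec; lookup; map)
  open import Data.Vec.Properties using (lookup-map)
  import Relation.Binary.PropositionalEquality as ≡

  data Expr (n : ℕ) : Set where
    var       : Fin n → Expr n
    zero one  : Expr n
    plus times : Expr n → Expr n → Expr n
    negate    : Expr n → Expr n

  exprOps : ∀ {n} → RingOps (Expr n)
  exprOps = record { 0# = zero ; 1# = one ; _+_ = plus ; _*_ = times ; -_ = negate }

  quaternary : (Expr 4 → Expr 4 → Expr 4 → Expr 4 → Expr 4) → Expr 4
  quaternary f = f (var Fin.zero) (var (Fin.suc Fin.zero)) (var (Fin.suc (Fin.suc Fin.zero)))
                   (var (Fin.suc (Fin.suc (Fin.suc Fin.zero))))

  module Evaluation {c ℓ} (R : CommutativeRing c ℓ) where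
    open CommutativeRing R

    ⟦_⟧ : ∀ {n} → Expr n → Vec Carrier n → Carrier
    ⟦ var i ⟧      ρ = lookup ρ i
    ⟦ zero ⟧       ρ = 0#
    ⟦ one ⟧        ρ = 1#
    ⟦ plus e f ⟧   ρ = ⟦ e ⟧ ρ + ⟦ f ⟧ ρ
    ⟦ times e f ⟧  ρ = ⟦ e ⟧ ρ * ⟦ f ⟧ ρ
    ⟦ negate e ⟧   ρ = - ⟦ e ⟧ ρ

    ⟦⟧-cong : ∀ {n} (e : Expr n) {ρ σ : Vec Carrier n} →
              (∀ i → lookup ρ i ≈ lookup σ i) → ⟦ e ⟧ ρ ≈ ⟦ e ⟧ σ
    ⟦⟧-cong (var i)     p = p i
    ⟦⟧-cong zero        p = refl
    ⟦⟧-cong one         p = refl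
    ⟦⟧-cong (plus e f)  p = +-cong (⟦⟧-cong e p) (⟦⟧-cong f p)
    ⟦⟧-cong (times e f) p = *-cong (⟦⟧-cong e p) (⟦⟧-cong f p)
    ⟦⟧-cong (negate e)  p = -‿cong (⟦⟧-cong e p)

  module Homomorphism {c ℓ c′ ℓ′} (K : CommutativeRing c ℓ) (L : CommutativeRing c′ ℓ′)
    (ι : CommutativeRing.Carrier K → CommutativeRing.Carrier L)
    (hom : RingMorphisms.IsRingHomomorphism (CommutativeRing.rawRing K) (CommutativeRing.rawRing L) ι)
    where
    module K = Evaluation K
    module L = Evaluation L
    open CommutativeRing L
    open RingMorphisms.IsRingHomomorphism hom

    ⟦⟧-homo : ∀ {n} (e : Expr n) (ρ : Vec (CommutativeRing.Carrier K) n) →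
              ι (K.⟦ e ⟧ ρ) ≈ L.⟦ e ⟧ (map ι ρ)
    ⟦⟧-homo (var i)     ρ = reflexive (≡.sym (lookup-map i ι ρ))
    ⟦⟧-homo zero        ρ = 0#-homo
    ⟦⟧-homo one         ρ = 1#-homo
    ⟦⟧-homo (plus e f)  ρ = trans (+-homo _ _) (+-cong (⟦⟧-homo e ρ) (⟦⟧-homo f ρ))
    ⟦⟧-homo (times e f) ρ = trans (*-homo _ _) (*-cong (⟦⟧-homo e ρ) (⟦⟧-homo f ρ))
    ⟦⟧-homo (negate e)  ρ = trans (-‿homo _) (-‿cong (⟦⟧-homo e ρ))

module FieldLemmas {c ℓ} (K : Field c ℓ) where
  open Field K hiding (zero)
  open FieldOps K using (_^_)
  open import Algebra.Properties.AbelianGroup +-abelianGroup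
    using (x∙y⁻¹≈ε⇒x≈y; x≈y⇒x∙y⁻¹≈ε; inverseˡ-unique)
  open import Relation.Binary.Reasoning.Setoid setoid
  open import Data.Product using (_,_)

  multiple : ∀ {m h} → h ≈ 0# → m * h ≈ 0#
  multiple h≈0 = trans (*-congˡ h≈0) (zeroʳ _)

  infixl 6 _⊕₀_
  _⊕₀_ : ∀ {x y} → x ≈ 0# → y ≈ 0# → x + y ≈ 0#
  x≈0 ⊕₀ y≈0 = trans (+-cong x≈0 y≈0) (+-identityˡ 0#)

  difference≈0 : ∀ {x y} → x ≈ y → x - y ≈ 0#
  difference≈0 = x≈y⇒x∙y⁻¹≈ε

  difference≈0⁻¹ : ∀ {x y} → x - y ≈ 0# → x ≈ y
  difference≈0⁻¹ = x∙y⁻¹≈ε⇒x≈y _ _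

  cancelˡ : ∀ {x y} → ¬ (x ≈ 0#) → x * y ≈ 0# → y ≈ 0#
  cancelˡ {x} {y} x≉0 xy≈0 with inverse x x≉0
  ... | x⁻¹ , xx⁻¹≈1 = begin
    y              ≈⟨ *-identityˡ y ⟨
    1# * y         ≈⟨ *-congʳ (trans (sym xx⁻¹≈1) (*-comm x x⁻¹)) ⟩
    x⁻¹ * x * y    ≈⟨ *-assoc x⁻¹ x y ⟩
    x⁻¹ * (x * y)  ≈⟨ multiple xy≈0 ⟩
    0#             ∎

  *-nonzero : ∀ {x y} → ¬ (x ≈ 0#) → ¬ (y ≈ 0#) → ¬ (x * y ≈ 0#)
  *-nonzero x≉0 y≉0 xy≈0 = y≉0 (cancelˡ x≉0 xy≈0)

  ^-nonzero : ∀ {x} n → ¬ (x ≈ 0#) → ¬ (x ^ n ≈ 0#)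
  ^-nonzero zero    x≉0 = 1≉0
  ^-nonzero (suc n) x≉0 = *-nonzero x≉0 (^-nonzero n x≉0)

  ≈-modulo : ∀ {x y z} → x ≈ y + z → z ≈ 0# → x ≈ y
  ≈-modulo {y = y} x≈y+z z≈0 = trans x≈y+z (trans (+-congˡ z≈0) (+-identityʳ y))

  sum≈0⇒≈- : ∀ {x y} → x + y ≈ 0# → x ≈ - y
  sum≈0⇒≈- = inverseˡ-unique _ _

module LinesOnCubics {c ℓ} (L : Field c ℓ) where
  open Field L
  open Bivariate L
  open IntegerSolver commutativeRing
  open Curve (ringOps commutativeRing)
    using (restriction₃; restriction₂; restriction₁; restriction₀)
  open FieldLemmas L
  open import Data.Nat using (_≤_)
  import Data.Nat.Properties as ℕₚ
  open import Data.Product using (_,_)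

  record LineOn (p : Poly) (a b : Carrier) : Set ℓ where
    field
      coeff₃ : restriction₃ p a b ≈ 0#
      coeff₂ : restriction₂ p a b ≈ 0#
      coeff₁ : restriction₁ p a b ≈ 0#
      coeff₀ : restriction₀ p a b ≈ 0#

  LineOn-resp : ∀ {p q a b} → (∀ i j → p i j ≈ q i j) → LineOn p a b → LineOn q a b
  LineOn-resp {p} {q} {a} {b} e line = record
    { coeff₃ = trans (sym r₃) (LineOn.coeff₃ line)
    ; coeff₂ = trans (sym r₂) (LineOn.coeff₂ line)
    ; coeff₁ = trans (sym r₁) (LineOn.coeff₁ line)
    ; coeff₀ = trans (sym r₀) (LineOn.coeff₀ line)
    }
    where
    r₃ : restriction₃ p a b ≈ restriction₃ q a b
    r₃ = +-cong (+-cong (+-cong (e 3 0) (*-congʳ (e 2 1))) (*-congʳ (e 1 2))) (*-congʳ (e 0 3))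
    r₂ : restriction₂ p a b ≈ restriction₂ q a b
    r₂ = +-cong (+-cong (+-cong (+-cong (+-cong (e 2 0) (*-congʳ (e 1 1))) (*-congʳ (e 0 2)))
                 (*-congʳ (e 2 1))) (*-congʳ (*-congʳ (*-congˡ (e 1 2)))))
                (*-congʳ (*-congʳ (*-congˡ (e 0 3))))
    r₁ : restriction₁ p a b ≈ restriction₁ q a b
    r₁ = +-cong (+-cong (+-cong (+-cong (+-cong (e 1 0) (*-congʳ (e 0 1))) (*-congʳ (e 1 1)))
                 (*-congʳ (*-congʳ (*-congˡ (e 0 2))))) (*-congʳ (e 1 2)))
                (*-congʳ (*-congʳ (*-congˡ (e 0 3))))
    r₀ : restriction₀ p a b ≈ restriction₀ q a b
    r₀ = +-cong (+-cong (+-cong (e 0 0) (*-congʳ (e 0 1))) (*-congʳ (e 0 2))) (*-congʳ (e 0 3))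

  -- A product (Y - aX - b)·G restricts to zero on the line Y = aX + b; we
  -- only need this when G has degree ≤ 2, where it is a polynomial identity.
  product-on-line : ∀ a b G → (∀ i j → i +ℕ j ≡ 3 → G i j ≈ 0#) → LineOn (lineTimes a b G) a b
  product-on-line a b G top≈0 = record
    { coeff₃ = trans
        (solve 12 (λ a b g₀₀ g₁₀ g₀₁ g₂₀ g₁₁ g₀₂ g₃₀ g₂₁ g₁₂ g₀₃ →
           S.restriction₃ (S.lineProduct a b (S.cubic g₀₀ g₁₀ g₀₁ g₂₀ g₁₁ g₀₂ g₃₀ g₂₁ g₁₂ g₀₃)) a b
           := (:- b) :* g₃₀ :+ (:- (a :* b)) :* g₂₁ :+ (:- (a :^ 2 :* b)) :* g₁₂ :+ (:- (a :^ 3 :* b)) :* g₀₃)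
         refl a b (G 0 0) (G 1 0) (G 0 1) (G 2 0) (G 1 1) (G 0 2) (G 3 0) (G 2 1) (G 1 2) (G 0 3))
        (multiple g₃₀≈0 ⊕₀ multiple g₂₁≈0 ⊕₀ multiple g₁₂≈0 ⊕₀ multiple g₀₃≈0)
    ; coeff₂ = trans
        (solve 12 (λ a b g₀₀ g₁₀ g₀₁ g₂₀ g₁₁ g₀₂ g₃₀ g₂₁ g₁₂ g₀₃ →
           S.restriction₂ (S.lineProduct a b (S.cubic g₀₀ g₁₀ g₀₁ g₂₀ g₁₁ g₀₂ g₃₀ g₂₁ g₁₂ g₀₃)) a b
           := (:- (b :^ 2)) :* g₂₁ :+ (:- (κ 2 :* a :* b :^ 2)) :* g₁₂ :+ (:- (κ 3 :* a :^ 2 :* b :^ 2)) :* g₀₃)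
         refl a b (G 0 0) (G 1 0) (G 0 1) (G 2 0) (G 1 1) (G 0 2) (G 3 0) (G 2 1) (G 1 2) (G 0 3))
        (multiple g₂₁≈0 ⊕₀ multiple g₁₂≈0 ⊕₀ multiple g₀₃≈0)
    ; coeff₁ = trans
        (solve 12 (λ a b g₀₀ g₁₀ g₀₁ g₂₀ g₁₁ g₀₂ g₃₀ g₂₁ g₁₂ g₀₃ →
           S.restriction₁ (S.lineProduct a b (S.cubic g₀₀ g₁₀ g₀₁ g₂₀ g₁₁ g₀₂ g₃₀ g₂₁ g₁₂ g₀₃)) a b
           := (:- (b :^ 3)) :* g₁₂ :+ (:- (κ 3 :* a :* b :^ 3)) :* g₀₃)
         refl a b (G 0 0) (G 1 0) (G 0 1) (G 2 0) (G 1 1) (G 0 2) (G 3 0) (G 2 1) (G 1 2) (G 0 3))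
        (multiple g₁₂≈0 ⊕₀ multiple g₀₃≈0)
    ; coeff₀ = trans
        (solve 12 (λ a b g₀₀ g₁₀ g₀₁ g₂₀ g₁₁ g₀₂ g₃₀ g₂₁ g₁₂ g₀₃ →
           S.restriction₀ (S.lineProduct a b (S.cubic g₀₀ g₁₀ g₀₁ g₂₀ g₁₁ g₀₂ g₃₀ g₂₁ g₁₂ g₀₃)) a b
           := (:- (b :^ 4)) :* g₀₃)
         refl a b (G 0 0) (G 1 0) (G 0 1) (G 2 0) (G 1 1) (G 0 2) (G 3 0) (G 2 1) (G 1 2) (G 0 3))
        (multiple g₀₃≈0)
    }
    where
    g₃₀≈0 : G 3 0 ≈ 0#
    g₃₀≈0 = top≈0 3 0 ≡.refl
    g₂₁≈0 : G 2 1 ≈ 0#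
    g₂₁≈0 = top≈0 2 1 ≡.refl
    g₁₂≈0 : G 1 2 ≈ 0#
    g₁₂≈0 = top≈0 1 2 ≡.refl
    g₀₃≈0 : G 0 3 ≈ 0#
    g₀₃≈0 = top≈0 0 3 ≡.refl

  module Quotient {a b : Carrier} {P G : Poly} (P≈ : ∀ i j → P i j ≈ lineTimes a b G i j) where

    -- The coefficient of X^i Y^(j+1) in P determines that of X^i Y^j in G
    -- from coefficients of G of larger total degree.
    peel : ∀ i j → P i (suc j) ≈ 0# → shiftX G i (suc j) ≈ 0# → G i (suc j) ≈ 0# → G i j ≈ 0#
    peel i j p≈0 s≈0 g≈0 = trans
      (solve 5 (λ a b g s g′ → g := (g :- a :* s :- b :* g′) :+ a :* s :+ b :* g′)
         refl a b (G i j) (shiftX G i (suc j)) (G i (suc j)))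
      (trans (sym (P≈ i (suc j))) p≈0 ⊕₀ multiple s≈0 ⊕₀ multiple g≈0)

    top-degree : ∀ d → (∀ i j → i +ℕ j ≡ suc d → P i j ≈ 0#) →
                 (∀ i j → i +ℕ j ≡ suc d → G i j ≈ 0#) →
                 ∀ i j → i +ℕ j ≡ d → G i j ≈ 0#
    top-degree d P≈0 G≈0 zero j i+j≡d =
      peel 0 j (P≈0 0 (suc j) (≡.cong suc i+j≡d)) refl (G≈0 0 (suc j) (≡.cong suc i+j≡d))
    top-degree d P≈0 G≈0 (suc i) j i+j≡d =
      peel (suc i) j (P≈0 (suc i) (suc j) degree)
           (top-degree d P≈0 G≈0 i (suc j) (≡.trans (ℕₚ.+-suc i j) i+j≡d))
           (G≈0 (suc i) (suc j) degree)
      where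
      degree : suc i +ℕ suc j ≡ suc d
      degree = ≡.cong suc (≡.trans (ℕₚ.+-suc i j) i+j≡d)

    quotient-degree : ∀ n → IsPolynomial G → (∀ i j → n < i +ℕ j → P i j ≈ 0#) →
                      ∀ i j → n ≤ i +ℕ j → G i j ≈ 0#
    quotient-degree n (N , G-bounded) P≈0 i j n≤i+j =
      vanish (suc N) (i +ℕ j) n≤i+j (ℕₚ.m≤n+m (suc N) (i +ℕ j)) i j ≡.refl
      where
      -- Downward induction on the degree d, starting above the bound N of G.
      vanish : ∀ k d → n ≤ d → N < d +ℕ k → ∀ i j → i +ℕ j ≡ d → G i j ≈ 0#
      vanish zero d _ N<d+0 i j i+j≡d =
        G-bounded i j (≡.subst (N <_) (≡.trans (ℕₚ.+-identityʳ d) (≡.sym i+j≡d)) N<d+0)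
      vanish (suc k) d n≤d N<d+k+1 = top-degree d
        (λ i j i+j≡d+1 → P≈0 i j (≡.subst (n <_) (≡.sym i+j≡d+1) (s≤s n≤d)))
        (vanish k (suc d) (ℕₚ.m≤n⇒m≤1+n n≤d) (≡.subst (N <_) (ℕₚ.+-suc d k) N<d+k+1))

  divides⇒LineOn : ∀ {a b P} → LineDivides a b P → (∀ i j → 3 < i +ℕ j → P i j ≈ 0#) → LineOn P a b
  divides⇒LineOn {a} {b} (G , G-poly , P≈) cubic = LineOn-resp (λ i j → sym (P≈ i j))
    (product-on-line a b G (λ i j i+j≡3 →
      Quotient.quotient-degree P≈ 3 G-poly cubic i j (≡.subst (3 ≤_) (≡.sym i+j≡3) ℕₚ.≤-refl)))

module Classical where

  return : ∀ {q} {Q : Set q} → Q → ¬ ¬ Q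
  return q ¬q = ¬q q

  by-cases : ∀ {p q} {P : Set p} {Q : Set q} → (P → ¬ ¬ Q) → (¬ P → ¬ ¬ Q) → ¬ ¬ Q
  by-cases if-P if-¬P ¬q = if-¬P (λ p → if-P p ¬q) ¬q

module SymmetricCubic {c ℓ} (L : Field c ℓ) where
  open Field L hiding (zero)
  open FieldOps L using (_^_)
  open IntegerSolver commutativeRing
  open Curve (ringOps commutativeRing)
  open FieldLemmas L
  open LinesOnCubics L using (LineOn; module LineOn)
  open Expressions using (exprOps; quaternary; module Evaluation)
  open Evaluation commutativeRing using (⟦⟧-cong)
  open Classical
  open import Data.Fin using (zero; suc)
  open import Data.Vec using (Vec; []; _∷_; lookup)
  open import Data.Product using (_×_; _,_)
  open import Data.Sum using (_⊎_; inj₁; inj₂)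
  open import Function using (_∘_)

  LineCriterion : Carrier → Carrier → Carrier → Carrier → Set ℓ
  LineCriterion C₀ C₁ C₂ C₃ =
    (Ψ C₀ C₁ C₂ C₃ ≈ 0#)
    ⊎ ((X₁ C₀ C₁ C₂ C₃ ≈ 0#) × (X₂ C₀ C₁ C₂ C₃ ≈ 0#))
    ⊎ ((W₁ C₀ C₁ C₂ C₃ ≈ 0#) × (W₂ C₀ C₁ C₂ C₃ ≈ 0#))

  criterion? : (∀ x y → Dec (x ≈ y)) → ∀ C₀ C₁ C₂ C₃ → Dec (LineCriterion C₀ C₁ C₂ C₃)
  criterion? _≟_ C₀ C₁ C₂ C₃ =
    (Ψ C₀ C₁ C₂ C₃ ≟ 0#)
    ⊎-dec ((X₁ C₀ C₁ C₂ C₃ ≟ 0#) ×-dec (X₂ C₀ C₁ C₂ C₃ ≟ 0#))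
    ⊎-dec ((W₁ C₀ C₁ C₂ C₃ ≟ 0#) ×-dec (W₂ C₀ C₁ C₂ C₃ ≟ 0#))
    where open import Relation.Nullary.Decidable using (_⊎-dec_; _×-dec_)

  -- Ψ is a cubic form, so its zero set is a cone: if s C = t D with s ≠ 0,
  -- then Ψ(D) = 0 implies Ψ(C) = 0.
  Ψ-cone : ∀ {s t C₀ C₁ C₂ C₃ D₀ D₁ D₂ D₃} → ¬ (s ≈ 0#) →
           s * C₀ ≈ t * D₀ → s * C₁ ≈ t * D₁ → s * C₂ ≈ t * D₂ → s * C₃ ≈ t * D₃ →
           Ψ D₀ D₁ D₂ D₃ ≈ 0# → Ψ C₀ C₁ C₂ C₃ ≈ 0#
  Ψ-cone {s} {t} {C₀} {C₁} {C₂} {C₃} {D₀} {D₁} {D₂} {D₃} s≉0 e₀ e₁ e₂ e₃ ΨD≈0 =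
    cancelˡ (^-nonzero 3 s≉0) (begin
      s ^ 3 * Ψ C₀ C₁ C₂ C₃                    ≈⟨ scaling s C₀ C₁ C₂ C₃ ⟩
      Ψ (s * C₀) (s * C₁) (s * C₂) (s * C₃)   ≈⟨ ⟦⟧-cong (quaternary Forms.Ψ) {sC} {tD} equal ⟩
      Ψ (t * D₀) (t * D₁) (t * D₂) (t * D₃)   ≈⟨ scaling t D₀ D₁ D₂ D₃ ⟨
      t ^ 3 * Ψ D₀ D₁ D₂ D₃                    ≈⟨ multiple ΨD≈0 ⟩
      0#                                       ∎)
    where
    open import Relation.Binary.Reasoning.Setoid setoid
    module Forms = Curve (exprOps {4})
    scaling : ∀ u x₀ x₁ x₂ x₃ → u ^ 3 * Ψ x₀ x₁ x₂ x₃ ≈ Ψ (u * x₀) (u * x₁) (u * x₂) (u * x₃)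
    scaling = solve 5 (λ u x₀ x₁ x₂ x₃ →
      u :^ 3 :* S.Ψ x₀ x₁ x₂ x₃ := S.Ψ (u :* x₀) (u :* x₁) (u :* x₂) (u :* x₃)) refl
    sC tD : Vec Carrier 4
    sC = s * C₀ ∷ s * C₁ ∷ s * C₂ ∷ s * C₃ ∷ []
    tD = t * D₀ ∷ t * D₁ ∷ t * D₂ ∷ t * D₃ ∷ []
    equal : ∀ i → lookup sC i ≈ lookup tD i
    equal zero                   = e₀
    equal (suc zero)             = e₁
    equal (suc (suc zero))       = e₂
    equal (suc (suc (suc zero))) = e₃

  module _ {C₀ C₁ C₂ C₃ : Carrier} where

    OnF : Carrier → Carrier → Set ℓ
    OnF = LineOn (symmetricCubic C₀ C₁ C₂ C₃)

    open LineOn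

    -- A line Y = b is not on F_C, since E₃ = C₀ ≠ 0 for a = 0; and a line
    -- through the origin is not on F_C, since F_C(0,0) = C₀ ≠ 0.
    slope≉0 : ∀ {a b} → ¬ (C₀ ≈ 0#) → OnF a b → ¬ (a ≈ 0#)
    slope≉0 {a} {b} C₀≉0 line a≈0 = C₀≉0 (trans
      (solve 6 (λ C₀ C₁ C₂ C₃ a b →
         C₀ := 𝟏 :* S.E₃ C₀ C₁ C₂ C₃ a b :+ (:- (C₁ :+ C₂ :* a :+ C₀ :* a :^ 2)) :* a)
       refl C₀ C₁ C₂ C₃ a b)
      (multiple (coeff₃ line) ⊕₀ multiple a≈0))

    intercept≉0 : ∀ {a b} → ¬ (C₀ ≈ 0#) → OnF a b → ¬ (b ≈ 0#)
    intercept≉0 {a} {b} C₀≉0 line b≈0 = C₀≉0 (trans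
      (solve 6 (λ C₀ C₁ C₂ C₃ a b →
         C₀ := 𝟏 :* S.E₀ C₀ C₁ C₂ C₃ a b :+ (:- (C₂ :+ C₁ :* b :+ C₀ :* b :^ 2)) :* b)
       refl C₀ C₁ C₂ C₃ a b)
      (multiple (coeff₀ line) ⊕₀ multiple b≈0))

    -- Elimination: (ab - 1)·(n₀ Cₖ - C₀ nₖ) lies in the ideal of E₃,…,E₀, so
    -- for ab ≠ 1 the vector C is proportional to n(a,b).
    module _ {a b} (line : OnF a b) (ab≉1 : ¬ (a * b ≈ 1#)) where
      private
        eliminate : ∀ {x y} → (a * b - 1#) * (x - y) ≈ 0# → x ≈ y
        eliminate = difference≈0⁻¹ ∘ cancelˡ (ab≉1 ∘ difference≈0⁻¹)

      proportional₁ : n₀ a b * C₁ ≈ C₀ * n₁ a b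
      proportional₁ = eliminate (trans
        (solve 6 (λ C₀ C₁ C₂ C₃ a b →
           (a :* b :- 𝟏) :* (S.n₀ a b :* C₁ :- C₀ :* S.n₁ a b)
           := b :* S.E₃ C₀ C₁ C₂ C₃ a b :+ (:- (a :^ 2)) :* S.E₀ C₀ C₁ C₂ C₃ a b)
         refl C₀ C₁ C₂ C₃ a b)
        (multiple (coeff₃ line) ⊕₀ multiple (coeff₀ line)))

      proportional₂ : n₀ a b * C₂ ≈ C₀ * n₂ a b
      proportional₂ = eliminate (trans
        (solve 6 (λ C₀ C₁ C₂ C₃ a b →
           (a :* b :- 𝟏) :* (S.n₀ a b :* C₂ :- C₀ :* S.n₂ a b)
           := (:- (b :^ 2)) :* S.E₃ C₀ C₁ C₂ C₃ a b :+ a :* S.E₀ C₀ C₁ C₂ C₃ a b)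
         refl C₀ C₁ C₂ C₃ a b)
        (multiple (coeff₃ line) ⊕₀ multiple (coeff₀ line)))

      proportional₃ : n₀ a b * C₃ ≈ C₀ * n₃ a b
      proportional₃ = eliminate (trans
        (solve 6 (λ C₀ C₁ C₂ C₃ a b →
           (a :* b :- 𝟏) :* (S.n₀ a b :* C₃ :- C₀ :* S.n₃ a b)
           := (𝟏 :- a :* b :+ κ 3 :* b :^ 3) :* S.E₃ C₀ C₁ C₂ C₃ a b
              :+ (κ 2 :* b :- κ 2 :* a :* b :^ 2) :* S.E₂ C₀ C₁ C₂ C₃ a b
              :+ (a :^ 2 :* b :- a) :* S.E₁ C₀ C₁ C₂ C₃ a b
              :+ (:- (κ 2 :+ a :* b)) :* S.E₀ C₀ C₁ C₂ C₃ a b)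
         refl C₀ C₁ C₂ C₃ a b)
        (multiple (coeff₃ line) ⊕₀ multiple (coeff₂ line) ⊕₀ multiple (coeff₁ line) ⊕₀ multiple (coeff₀ line)))

    Ψ-at-n : ∀ a b → Ψ (n₀ a b) (n₁ a b) (n₂ a b) (n₃ a b) ≈ 0#
    Ψ-at-n = solve 2 (λ a b → S.Ψ (S.n₀ a b) (S.n₁ a b) (S.n₂ a b) (S.n₃ a b) := 𝟎) refl

    Ψ-vanishes : ∀ {a b} → ¬ (C₀ ≈ 0#) → OnF a b → ¬ (a * b ≈ 1#) → Ψ C₀ C₁ C₂ C₃ ≈ 0#
    Ψ-vanishes {a} {b} C₀≉0 line ab≉1 =
      Ψ-cone n₀≉0 (*-comm _ _) (proportional₁ line ab≉1) (proportional₂ line ab≉1)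
             (proportional₃ line ab≉1) (Ψ-at-n a b)
      where
      n₀≉0 : ¬ (n₀ a b ≈ 0#)
      n₀≉0 n₀≈0 = *-nonzero (slope≉0 C₀≉0 line) (intercept≉0 C₀≉0 line)
        (trans (solve 2 (λ a b → a :* b := (:- 𝟏) :* S.n₀ a b) refl a b) (multiple n₀≈0))

    module _ {a b} (line : OnF a b) (ab≈1 : a * b ≈ 1#) where
      private
        ab-1≈0 : a * b - 1# ≈ 0#
        ab-1≈0 = difference≈0 ab≈1

      -- The line Y = -b²X + b lies on F_C as well: each of its equations is a
      -- combination of those of Y = aX + b and of ab - 1.
      second-line₃ : E₃ C₀ C₁ C₂ C₃ (- b ^ 2) b ≈ 0#
      second-line₃ = trans
        (solve 6 (λ C₀ C₁ C₂ C₃ a b →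
           S.E₃ C₀ C₁ C₂ C₃ (:- (b :^ 2)) b
           := (:- (κ 3 :* b :^ 3)) :* S.E₃ C₀ C₁ C₂ C₃ a b
              :+ (b :^ 4 :+ κ 2 :* a :* b :^ 2 :- κ 2 :* b) :* S.E₂ C₀ C₁ C₂ C₃ a b
              :+ (:- (κ 2 :* a :* b :^ 3) :- a :^ 2 :* b :+ b :^ 2 :+ a) :* S.E₁ C₀ C₁ C₂ C₃ a b
              :+ (κ 3 :* a :^ 2 :* b :^ 2 :- b :^ 3 :- κ 3 :* a :* b :+ κ 4) :* S.E₀ C₀ C₁ C₂ C₃ a b
              :+ (κ 3 :* C₀ :+ C₁ :* a :+ κ 4 :* C₁ :* b :^ 2 :+ C₂ :* a :^ 2 :- C₂ :* a :* b :^ 2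
                  :+ κ 2 :* C₂ :* b :- C₃ :* a :* b :+ C₃ :* b :^ 3) :* (a :* b :- 𝟏))
         refl C₀ C₁ C₂ C₃ a b)
        (multiple (coeff₃ line) ⊕₀ multiple (coeff₂ line) ⊕₀ multiple (coeff₁ line)
         ⊕₀ multiple (coeff₀ line) ⊕₀ multiple ab-1≈0)

      second-line₂ : E₂ C₀ C₁ C₂ C₃ (- b ^ 2) b ≈ 0#
      second-line₂ = trans
        (solve 6 (λ C₀ C₁ C₂ C₃ a b →
           S.E₂ C₀ C₁ C₂ C₃ (:- (b :^ 2)) b
           := (κ 6 :* b :^ 2) :* S.E₃ C₀ C₁ C₂ C₃ a b
              :+ (κ 2 :- κ 2 :* b :^ 3 :- κ 2 :* a :* b) :* S.E₂ C₀ C₁ C₂ C₃ a b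
              :+ (κ 4 :* a :* b :^ 2 :- κ 3 :* b) :* S.E₁ C₀ C₁ C₂ C₃ a b
              :+ (κ 3 :* b :^ 2 :- κ 6 :* a :^ 2 :* b) :* S.E₀ C₀ C₁ C₂ C₃ a b
              :+ (κ 9 :* C₀ :* b :^ 2 :+ κ 2 :* C₁ :* a :^ 2 :- κ 2 :* C₁ :* b :+ C₂
                  :+ κ 2 :* C₃ :* a :- κ 2 :* C₃ :* b :^ 2) :* (a :* b :- 𝟏))
         refl C₀ C₁ C₂ C₃ a b)
        (multiple (coeff₃ line) ⊕₀ multiple (coeff₂ line) ⊕₀ multiple (coeff₁ line)
         ⊕₀ multiple (coeff₀ line) ⊕₀ multiple ab-1≈0)

      second-line₁ : E₁ C₀ C₁ C₂ C₃ (- b ^ 2) b ≈ 0#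
      second-line₁ = trans
        (solve 6 (λ C₀ C₁ C₂ C₃ a b →
           S.E₁ C₀ C₁ C₂ C₃ (:- (b :^ 2)) b
           := b :^ 2 :* S.E₂ C₀ C₁ C₂ C₃ a b :+ (𝟏 :- a :* b) :* S.E₁ C₀ C₁ C₂ C₃ a b
              :+ (:- (κ 3 :* b)) :* S.E₀ C₀ C₁ C₂ C₃ a b
              :+ (C₁ :* a :* b :- C₂ :* b :^ 2 :- κ 3 :* C₀ :* b :+ C₂ :* a) :* (a :* b :- 𝟏))
         refl C₀ C₁ C₂ C₃ a b)
        (multiple (coeff₂ line) ⊕₀ multiple (coeff₁ line) ⊕₀ multiple (coeff₀ line) ⊕₀ multiple ab-1≈0)

      second-line : OnF (- b ^ 2) b
      second-line = record { coeff₃ = second-line₃ ; coeff₂ = second-line₂ ; coeff₁ = second-line₁ ; coeff₀ = coeff₀ line }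

      X-case : b + 1# ≈ 0# → X₁ C₀ C₁ C₂ C₃ ≈ 0# × X₂ C₀ C₁ C₂ C₃ ≈ 0#
      X-case b+1≈0 =
          trans (solve 6 (λ C₀ C₁ C₂ C₃ a b →
                   S.X₁ C₀ C₁ C₂ C₃ := 𝟏 :* S.E₃ C₀ C₁ C₂ C₃ a b
                     :+ (C₂ :- C₀ :- C₁ :+ C₀ :* a :- C₂ :* a :- C₀ :* a :^ 2) :* (a :+ 𝟏))
                 refl C₀ C₁ C₂ C₃ a b)
                (multiple (coeff₃ line) ⊕₀ multiple a+1≈0)
        , trans (solve 6 (λ C₀ C₁ C₂ C₃ a b →
                   S.X₂ C₀ C₁ C₂ C₃ := 𝟏 :* S.E₂ C₀ C₁ C₂ C₃ a b
                     :+ (C₁ :- C₃ :- C₁ :* a :+ κ 3 :* C₀ :* b :- κ 2 :* C₂ :* b :- κ 3 :* C₀ :* a :* b) :* (a :+ 𝟏)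
                     :+ (κ 2 :* C₂ :- κ 3 :* C₀ :- C₁) :* (b :+ 𝟏))
                 refl C₀ C₁ C₂ C₃ a b)
                (multiple (coeff₂ line) ⊕₀ multiple a+1≈0 ⊕₀ multiple b+1≈0)
        where
        a+1≈0 : a + 1# ≈ 0#
        a+1≈0 = trans (solve 2 (λ a b → a :+ 𝟏 := (:- 𝟏) :* (a :* b :- 𝟏) :+ a :* (b :+ 𝟏)) refl a b)
                      (multiple ab-1≈0 ⊕₀ multiple b+1≈0)

      W-case : b ^ 2 - b + 1# ≈ 0# → W₁ C₀ C₁ C₂ C₃ ≈ 0# × W₂ C₀ C₁ C₂ C₃ ≈ 0#
      W-case b²-b+1≈0 =
          trans (solve 6 (λ C₀ C₁ C₂ C₃ a b →
                   S.W₁ C₀ C₁ C₂ C₃ := (C₁ :- C₁ :* a :- C₂ :* a) :* S.E₃ C₀ C₁ C₂ C₃ a b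
                     :+ (C₁ :^ 2 :+ C₁ :* C₂ :+ C₂ :^ 2 :- C₀ :* C₁ :+ C₀ :* C₂ :* a :+ C₁ :* C₂ :* a
                         :+ C₂ :^ 2 :* a :+ C₀ :* C₁ :* a :^ 2 :+ C₀ :* C₂ :* a :^ 2) :* (a :^ 2 :- a :+ 𝟏))
                 refl C₀ C₁ C₂ C₃ a b)
                (multiple (coeff₃ line) ⊕₀ multiple a²-a+1≈0)
        , trans (solve 6 (λ C₀ C₁ C₂ C₃ a b →
                   S.W₂ C₀ C₁ C₂ C₃ := (κ 3 :* C₂ :* b) :* S.E₃ C₀ C₁ C₂ C₃ a b
                     :+ (C₂ :- C₂ :* a) :* S.E₂ C₀ C₁ C₂ C₃ a b
                     :+ (κ 3 :* C₀ :* C₂ :+ κ 2 :* C₁ :* C₂ :+ C₂ :* C₃ :+ κ 3 :* C₂ :^ 2 :+ C₁ :* C₂ :* a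
                         :- κ 3 :* C₀ :* C₂ :* b :- C₂ :^ 2 :* b) :* (a :^ 2 :- a :+ 𝟏)
                     :+ (C₂ :^ 2 :- C₁ :* C₂ :- κ 3 :* C₀ :* C₂ :* a :- κ 2 :* C₁ :* C₂ :* a
                         :- κ 3 :* C₂ :^ 2 :* a) :* (a :+ b :- 𝟏))
                 refl C₀ C₁ C₂ C₃ a b)
                (multiple (coeff₃ line) ⊕₀ multiple (coeff₂ line) ⊕₀ multiple a²-a+1≈0 ⊕₀ multiple a+b-1≈0)
        where
        a²-a+1≈0 : a ^ 2 - a + 1# ≈ 0#
        a²-a+1≈0 = trans
          (solve 2 (λ a b → a :^ 2 :- a :+ 𝟏
                     := (a :- a :* b :- 𝟏) :* (a :* b :- 𝟏) :+ a :^ 2 :* (b :^ 2 :- b :+ 𝟏)) refl a b)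
          (multiple ab-1≈0 ⊕₀ multiple b²-b+1≈0)
        a+b-1≈0 : a + b - 1# ≈ 0#
        a+b-1≈0 = trans
          (solve 2 (λ a b → a :+ b :- 𝟏 := (𝟏 :- b) :* (a :* b :- 𝟏) :+ a :* (b :^ 2 :- b :+ 𝟏)) refl a b)
          (multiple ab-1≈0 ⊕₀ multiple b²-b+1≈0)

    line-criterion : ∀ {a b} → ¬ (C₀ ≈ 0#) → OnF a b → ¬ ¬ LineCriterion C₀ C₁ C₂ C₃
    line-criterion {a} {b} C₀≉0 line =
      by-cases ab≈1-case (λ ab≉1 → return (inj₁ (Ψ-vanishes C₀≉0 line ab≉1)))
      where
      -- b³ + 1 = (b + 1)(b² - b + 1).
      b²-b+1≈0 : b ^ 3 + 1# ≈ 0# → ¬ (b + 1# ≈ 0#) → b ^ 2 - b + 1# ≈ 0#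
      b²-b+1≈0 b³+1≈0 b+1≉0 = cancelˡ b+1≉0 (trans
        (solve 1 (λ b → (b :+ 𝟏) :* (b :^ 2 :- b :+ 𝟏) := 𝟏 :* (b :^ 3 :+ 𝟏)) refl b)
        (multiple b³+1≈0))

      -- For the second line, slope · intercept = -b³.
      second-slope : ¬ (b ^ 3 + 1# ≈ 0#) → ¬ ((- b ^ 2) * b ≈ 1#)
      second-slope b³+1≉0 slope≈1 = b³+1≉0 (trans
        (solve 1 (λ b → b :^ 3 :+ 𝟏 := (:- 𝟏) :* ((:- (b :^ 2)) :* b :- 𝟏)) refl b)
        (multiple (difference≈0 slope≈1)))

      ab≈1-case : a * b ≈ 1# → ¬ ¬ LineCriterion C₀ C₁ C₂ C₃
      ab≈1-case ab≈1 = by-cases b³≈-1-case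
        (λ b³+1≉0 → return (inj₁ (Ψ-vanishes C₀≉0 (second-line line ab≈1) (second-slope b³+1≉0))))
        where
        b³≈-1-case : b ^ 3 + 1# ≈ 0# → ¬ ¬ LineCriterion C₀ C₁ C₂ C₃
        b³≈-1-case b³+1≈0 = by-cases
          (λ b+1≈0 → return (inj₂ (inj₁ (X-case line ab≈1 b+1≈0))))
          (λ b+1≉0 → return (inj₂ (inj₂ (W-case line ab≈1 (b²-b+1≈0 b³+1≈0 b+1≉0)))))

module TheFamily {c ℓ} (K : Field c ℓ) (_≟_ : ∀ x y → Dec (Field._≈_ K x y))
  (2≉0 : ¬ (Field._≈_ K (FieldOps.fromℕ K 2) (Field.0# K)))
  {A B : Field.Carrier K} (A≉0 : ¬ (Field._≈_ K A (Field.0# K))) (B≉0 : ¬ (Field._≈_ K B (Field.0# K)))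
  where
  open Field K
  open FieldOps K
  open CurveF K
  open Conclusion K
  open IntegerSolver commutativeRing
  open Curve (ringOps commutativeRing) using (Ψ; X₁; X₂; W₁; W₂; Q₅)
  open FieldLemmas K
  open SymmetricCubic K using (LineCriterion)
  open import Data.Product using (_,_)
  open import Data.Sum using (_⊎_; inj₁; inj₂; [_,_]′)

  pattern case₁ p = inj₁ p
  pattern case₂ p = inj₂ (inj₁ p)
  pattern case₃ p = inj₂ (inj₂ (inj₁ p))
  pattern case₄ p = inj₂ (inj₂ (inj₂ (inj₁ p)))
  pattern case₅ p = inj₂ (inj₂ (inj₂ (inj₂ p)))

  zero-factor : ∀ {x y} → x * y ≈ 0# → x ≈ 0# ⊎ y ≈ 0#
  zero-factor {x} xy≈0 with x ≟ 0#
  ... | yes x≈0 = inj₁ x≈0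
  ... | no  x≉0 = inj₂ (cancelˡ x≉0 xy≈0)

  square-zero : ∀ {x} → x ^ 2 ≈ 0# → x ≈ 0#
  square-zero x²≈0 = [ (λ x≈0 → x≈0) , (λ x≈0 → x≈0) ]′
    (zero-factor (trans (sym (*-congˡ (*-identityʳ _))) x²≈0))

  -- Ψ(c(A,B)) = 8B (A³ - 2AB + 1)² (A - B²).
  Ψ-factors : Ψ (c₀ A B) (c₁ A B) (c₂ A B) (c₃ A B) ≈ 0# →
              (A ^ 3 - fromℕ 2 * A * B + 1#) ^ 2 * (A - B ^ 2) ≈ 0#
  Ψ-factors Ψ≈0 = cancelˡ (*-nonzero (^-nonzero 3 2≉0) B≉0) (trans
    (solve 2 (λ A B → κ 2 :^ 3 :* B :* ((A :^ 3 :- κ 2 :* A :* B :+ 𝟏) :^ 2 :* (A :- B :^ 2))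
                      := S.Ψ (S.c₀ A B) (S.c₁ A B) (S.c₂ A B) (S.c₃ A B)) refl A B)
    Ψ≈0)

  Ψ-case : Ψ (c₀ A B) (c₁ A B) (c₂ A B) (c₃ A B) ≈ 0# → Concl A B
  Ψ-case Ψ≈0 = [ (λ square≈0 → case₂ (square-zero square≈0 , cube+1≉0 (square-zero square≈0)))
               , (λ A-B²≈0 → case₄ (difference≈0⁻¹ A-B²≈0)) ]′ (zero-factor (Ψ-factors Ψ≈0))
    where
    -- 2AB = (A³ + 1) - (A³ - 2AB + 1) is nonzero.
    cube+1≉0 : A ^ 3 - fromℕ 2 * A * B + 1# ≈ 0# → ¬ (A ^ 3 + 1# ≈ 0#)
    cube+1≉0 cubic≈0 A³+1≈0 = *-nonzero (*-nonzero 2≉0 A≉0) B≉0 (trans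
      (solve 2 (λ A B → κ 2 :* A :* B := 𝟏 :* (A :^ 3 :+ 𝟏) :+ (:- 𝟏) :* (A :^ 3 :- κ 2 :* A :* B :+ 𝟏)) refl A B)
      (multiple A³+1≈0 ⊕₀ multiple cubic≈0))

  -- The X-condition gives case (1): X₁(c(A,B)) = 2B (A - 2B + 1)(1 - A), and
  -- for A = 1, X₂(c(A,B)) = -4 (B - 1)² (2B + 1).
  X-case : X₁ (c₀ A B) (c₁ A B) (c₂ A B) (c₃ A B) ≈ 0# → X₂ (c₀ A B) (c₁ A B) (c₂ A B) (c₃ A B) ≈ 0# → Concl A B
  X-case X₁≈0 X₂≈0 = [ (λ line≈0 → case₁ (inj₁ line≈0))
                     , (λ 1-A≈0 → A≈1-case (sym (difference≈0⁻¹ 1-A≈0))) ]′ (zero-factor X₁-factors)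
    where
    X₁-factors : (A - fromℕ 2 * B + 1#) * (1# - A) ≈ 0#
    X₁-factors = cancelˡ (*-nonzero 2≉0 B≉0) (trans
      (solve 2 (λ A B → κ 2 :* B :* ((A :- κ 2 :* B :+ 𝟏) :* (𝟏 :- A))
                        := S.X₁ (S.c₀ A B) (S.c₁ A B) (S.c₂ A B) (S.c₃ A B)) refl A B)
      X₁≈0)
    A≈1-case : A ≈ 1# → Concl A B
    A≈1-case A≈1 = [ (λ B-1²≈0 → case₁ (inj₂ (inj₁ (A≈1 , difference≈0⁻¹ (square-zero B-1²≈0)))))
                   , (λ 2B+1≈0 → case₁ (inj₂ (inj₂ (A≈1 , sum≈0⇒≈- 2B+1≈0)))) ]′ (zero-factor X₂-factors)
      where
      X₂-factors : (B - 1#) ^ 2 * (fromℕ 2 * B + 1#) ≈ 0#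
      X₂-factors = cancelˡ (^-nonzero 2 2≉0) (trans
        (solve 2 (λ A B → κ 2 :^ 2 :* ((B :- 𝟏) :^ 2 :* (κ 2 :* B :+ 𝟏))
           := (:- 𝟏) :* S.X₂ (S.c₀ A B) (S.c₁ A B) (S.c₂ A B) (S.c₃ A B)
              :+ (κ 12 :* B :^ 2 :- κ 6 :* B :- κ 2 :* A :^ 2 :- κ 2 :* A :- κ 2) :* (A :- 𝟏)) refl A B)
        (multiple X₂≈0 ⊕₀ multiple (difference≈0 A≈1)))

  -- W₁(c(A,B)) = 4B² Q₅ (A² + A + 1) and W₂(c(A,B)) = 4B Q₅ (2AB + 1)(A + B + 1).
  W₁-factors : W₁ (c₀ A B) (c₁ A B) (c₂ A B) (c₃ A B) ≈ 0# → Q₅ A B * (A ^ 2 + A + 1#) ≈ 0#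
  W₁-factors W₁≈0 = cancelˡ (*-nonzero (^-nonzero 2 2≉0) (^-nonzero 2 B≉0)) (trans
    (solve 2 (λ A B → κ 2 :^ 2 :* B :^ 2 :* (S.Q₅ A B :* (A :^ 2 :+ A :+ 𝟏))
                      := S.W₁ (S.c₀ A B) (S.c₁ A B) (S.c₂ A B) (S.c₃ A B)) refl A B)
    W₁≈0)

  W₂-factors : W₂ (c₀ A B) (c₁ A B) (c₂ A B) (c₃ A B) ≈ 0# → Q₅ A B * ((fromℕ 2 * A * B + 1#) * (A + B + 1#)) ≈ 0#
  W₂-factors W₂≈0 = cancelˡ (*-nonzero (^-nonzero 2 2≉0) B≉0) (trans
    (solve 2 (λ A B → κ 2 :^ 2 :* B :* (S.Q₅ A B :* ((κ 2 :* A :* B :+ 𝟏) :* (A :+ B :+ 𝟏)))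
                      := S.W₂ (S.c₀ A B) (S.c₁ A B) (S.c₂ A B) (S.c₃ A B)) refl A B)
    W₂≈0)

  -- Q₅ = 0 gives case (5), or case (1) when 2B + 1 = 0:
  -- ((2A + 2B - 1)/(2B + 1))² = -3 + 4Q₅/(2B + 1)², and (A - 1)² = Q₅ - (2B + 1)(A + 2B).
  Q₅-case : Q₅ A B ≈ 0# → Concl A B
  Q₅-case Q₅≈0 with (fromℕ 2 * B + 1#) ≟ 0#
  ... | yes 2B+1≈0 = case₁ (inj₂ (inj₂ (difference≈0⁻¹ (square-zero A-1²≈0) , sum≈0⇒≈- 2B+1≈0)))
    where
    A-1²≈0 : (A - 1#) ^ 2 ≈ 0#
    A-1²≈0 = trans
      (solve 2 (λ A B → (A :- 𝟏) :^ 2 := 𝟏 :* S.Q₅ A B :+ (:- (A :+ κ 2 :* B)) :* (κ 2 :* B :+ 𝟏)) refl A B)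
      (multiple Q₅≈0 ⊕₀ multiple 2B+1≈0)
  ... | no 2B+1≉0 with inverse (fromℕ 2 * B + 1#) 2B+1≉0
  ... | y , [2B+1]y≈1 = case₅ (Q₅≈0 , (fromℕ 2 * A + fromℕ 2 * B - 1#) * y , ≈-modulo
    (solve 3 (λ A B y → ((κ 2 :* A :+ κ 2 :* B :- 𝟏) :* y) :* ((κ 2 :* A :+ κ 2 :* B :- 𝟏) :* y)
               := :- κ 3 :+ (κ 4 :* y :^ 2 :* S.Q₅ A B
                             :+ (:- (κ 3 :* ((κ 2 :* B :+ 𝟏) :* y :+ 𝟏))) :* ((κ 2 :* B :+ 𝟏) :* y :- 𝟏))) refl A B y)
    (multiple Q₅≈0 ⊕₀ multiple (difference≈0 [2B+1]y≈1)))

  -- If Q₅ ≠ 0 then A² + A + 1 = 0, so -3 = (2A + 1)², and B = A² or 2B = -A²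
  -- (using A³ = 1): this is case (3).
  cyclotomic-case : A ^ 2 + A + 1# ≈ 0# → (fromℕ 2 * A * B + 1#) * (A + B + 1#) ≈ 0# → Concl A B
  cyclotomic-case A²+A+1≈0 product≈0 = case₃ (A²+A+1≈0 , B-choice , fromℕ 2 * A + 1# , ≈-modulo
    (solve 1 (λ A → (κ 2 :* A :+ 𝟏) :* (κ 2 :* A :+ 𝟏) := :- κ 3 :+ κ 4 :* (A :^ 2 :+ A :+ 𝟏)) refl A)
    (multiple A²+A+1≈0))
    where
    B-choice : B ≈ A ^ 2 ⊎ fromℕ 2 * B ≈ - (A ^ 2)
    B-choice = [ (λ 2AB+1≈0 → inj₂ (≈-modulo
                   (solve 2 (λ A B → κ 2 :* B := :- A :^ 2 :+ (A :^ 2 :* (κ 2 :* A :* B :+ 𝟏)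
                                      :+ (:- (κ 2 :* B :* (A :- 𝟏))) :* (A :^ 2 :+ A :+ 𝟏))) refl A B)
                   (multiple 2AB+1≈0 ⊕₀ multiple A²+A+1≈0)))
               , (λ A+B+1≈0 → inj₁ (≈-modulo
                   (solve 2 (λ A B → B := A :^ 2 :+ (𝟏 :* (A :+ B :+ 𝟏) :+ (:- 𝟏) :* (A :^ 2 :+ A :+ 𝟏))) refl A B)
                   (multiple A+B+1≈0 ⊕₀ multiple A²+A+1≈0))) ]′ (zero-factor product≈0)

  W-case : W₁ (c₀ A B) (c₁ A B) (c₂ A B) (c₃ A B) ≈ 0# → W₂ (c₀ A B) (c₁ A B) (c₂ A B) (c₃ A B) ≈ 0# → Concl A B
  W-case W₁≈0 W₂≈0 with Q₅ A B ≟ 0#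
  ... | yes Q₅≈0 = Q₅-case Q₅≈0
  ... | no  Q₅≉0 = cyclotomic-case (cancelˡ Q₅≉0 (W₁-factors W₁≈0)) (cancelˡ Q₅≉0 (W₂-factors W₂≈0))

  criterion⇒conclusion : LineCriterion (c₀ A B) (c₁ A B) (c₂ A B) (c₃ A B) → Concl A B
  criterion⇒conclusion (inj₁ Ψ≈0)                = Ψ-case Ψ≈0
  criterion⇒conclusion (inj₂ (inj₁ (X₁≈0 , X₂≈0))) = X-case X₁≈0 X₂≈0
  criterion⇒conclusion (inj₂ (inj₂ (W₁≈0 , W₂≈0))) = W-case W₁≈0 W₂≈0

module FieldHomomorphism {c ℓ c′ ℓ′} (K : Field c ℓ) (L : Field c′ ℓ′)
  (ι : Field.Carrier K → Field.Carrier L)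
  (hom : RingMorphisms.IsRingHomomorphism (Field.rawRing K) (Field.rawRing L) ι)
  where
  private
    module K = Field K
    module L = Field L
  open RingMorphisms.IsRingHomomorphism hom
  open import Data.Product using (_,_)
  open import Data.Vec using (Vec; []; _∷_; map)
  open import Data.Sum using (inj₁; inj₂)
  open Expressions using (Expr; exprOps; quaternary)
  open Expressions.Homomorphism K.commutativeRing L.commutativeRing ι hom using (⟦⟧-homo)

  nonzero-preserved : ∀ {x} → ¬ (x K.≈ K.0#) → ¬ (ι x L.≈ L.0#)
  nonzero-preserved {x} x≉0 ιx≈0 with K.inverse x x≉0
  ... | y , xy≈1 = L.1≉0 (begin
    L.1#         ≈⟨ 1#-homo ⟨
    ι K.1#       ≈⟨ ⟦⟧-cong xy≈1 ⟨
    ι (x K.* y)  ≈⟨ *-homo x y ⟩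
    ι x L.* ι y  ≈⟨ L.*-congʳ ιx≈0 ⟩
    L.0# L.* ι y ≈⟨ L.zeroˡ _ ⟩
    L.0#         ∎)
    where open import Relation.Binary.Reasoning.Setoid L.setoid

  zero-reflected : (∀ x y → Dec (x K.≈ y)) → ∀ {x} → ι x L.≈ L.0# → x K.≈ K.0#
  zero-reflected _≟_ {x} ιx≈0 = decidable-stable (x ≟ K.0#) (λ x≉0 → nonzero-preserved x≉0 ιx≈0)

  module _ (_≟_ : ∀ x y → Dec (x K.≈ y)) {C₀ C₁ C₂ C₃ : K.Carrier} where
    private
      module EK = Expressions.Evaluation K.commutativeRing
      module EL = Expressions.Evaluation L.commutativeRing
      module Forms = Curve (exprOps {4})
      module CK = SymmetricCubic K
      module CL = SymmetricCubic L

      C : Vec K.Carrier 4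
      C = C₀ ∷ C₁ ∷ C₂ ∷ C₃ ∷ []

      descend : (e : Expr 4) → EL.⟦ e ⟧ (map ι C) L.≈ L.0# → EK.⟦ e ⟧ C K.≈ K.0#
      descend e ιe≈0 = zero-reflected _≟_ (L.trans (⟦⟧-homo e C) ιe≈0)

    criterion-descends : CL.LineCriterion (ι C₀) (ι C₁) (ι C₂) (ι C₃) → CK.LineCriterion C₀ C₁ C₂ C₃
    criterion-descends (inj₁ Ψ≈0)                = inj₁ (descend (quaternary Forms.Ψ) Ψ≈0)
    criterion-descends (inj₂ (inj₁ (X₁≈0 , X₂≈0))) = inj₂ (inj₁ (descend (quaternary Forms.X₁) X₁≈0 , descend (quaternary Forms.X₂) X₂≈0))
    criterion-descends (inj₂ (inj₂ (W₁≈0 , W₂≈0))) = inj₂ (inj₂ (descend (quaternary Forms.W₁) W₁≈0 , descend (quaternary Forms.W₂) W₂≈0))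

module Parity where
  open import Data.Nat.Divisibility using (_∣_; divides; ∣-refl; ∣m∣n⇒∣m+n; ∣1⇒≡1)
  open import Data.Nat.Primality using (euclidsLemma; prime[2])
  open import Data.Fin using (Fin; zero; suc; punchIn; punchOut)
  open import Data.Fin.Properties using (punchIn-injective; punchInᵢ≢i; punchIn-punchOut; suc-injective; 0≢1+n)
  open import Data.Sum using (inj₁; inj₂)
  open import Data.Empty using (⊥-elim)
  open import Function using (_∘_)
  open import Relation.Binary.PropositionalEquality using (_≡_; _≢_; refl; sym; trans; cong)

  involution⇒even : ∀ n (g : Fin n → Fin n) → (∀ i → g (g i) ≡ i) → (∀ i → g i ≢ i) → 2 ∣ n
  involution⇒even zero          g g∘g≡id fixed-free = divides 0 refl
  involution⇒even (suc zero)    g g∘g≡id fixed-free = ⊥-elim (fixed-free zero (only (g zero)))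
    where
    only : (i : Fin 1) → i ≡ zero
    only zero = refl
  involution⇒even (suc (suc n)) g g∘g≡id fixed-free with g zero in g0≡
  ... | zero  = ⊥-elim (fixed-free zero g0≡)
  ... | suc j = ∣m∣n⇒∣m+n ∣-refl (involution⇒even n h h∘h≡id h-fixed-free)
    where
    -- The elements other than zero and g zero = suc j.
    rest : Fin n → Fin (suc (suc n))
    rest k = suc (punchIn j k)

    rest-injective : ∀ {k l} → rest k ≡ rest l → k ≡ l
    rest-injective = punchIn-injective j _ _ ∘ suc-injective

    unrest : (y : Fin (suc (suc n))) → y ≢ zero → y ≢ suc j → Fin n
    unrest zero    y≢0 _    = ⊥-elim (y≢0 refl)
    unrest (suc m) _   y≢sj = punchOut (λ j≡m → y≢sj (cong suc (sym j≡m)))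

    rest-unrest : ∀ y (y≢0 : y ≢ zero) (y≢sj : y ≢ suc j) → rest (unrest y y≢0 y≢sj) ≡ y
    rest-unrest zero    y≢0 _    = ⊥-elim (y≢0 refl)
    rest-unrest (suc m) _   y≢sj = cong suc (punchIn-punchOut _)

    -- g maps the rest to the rest, since it swaps zero and suc j.
    g-rest≢0 : ∀ k → g (rest k) ≢ zero
    g-rest≢0 k g≡0 = punchInᵢ≢i j k (suc-injective (trans (sym (g∘g≡id (rest k))) (trans (cong g g≡0) g0≡)))

    g-rest≢sj : ∀ k → g (rest k) ≢ suc j
    g-rest≢sj k g≡sj = 0≢1+n (sym (trans (sym (g∘g≡id (rest k))) (trans (cong g g≡sj)
                               (trans (cong g (sym g0≡)) (g∘g≡id zero)))))

    h : Fin n → Fin n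
    h k = unrest (g (rest k)) (g-rest≢0 k) (g-rest≢sj k)

    rest∘h : ∀ k → rest (h k) ≡ g (rest k)
    rest∘h k = rest-unrest (g (rest k)) (g-rest≢0 k) (g-rest≢sj k)

    h∘h≡id : ∀ k → h (h k) ≡ k
    h∘h≡id k = rest-injective (trans (rest∘h (h k)) (trans (cong g (rest∘h k)) (g∘g≡id (rest k))))

    h-fixed-free : ∀ k → h k ≢ k
    h-fixed-free k hk≡k = fixed-free (rest k) (trans (sym (rest∘h k)) (cong rest hk≡k))

  odd-power : ∀ {p} → ¬ (2 ∣ p) → ∀ n → ¬ (2 ∣ p ℕ.^ n)
  odd-power 2∤p zero    2∣1 with ∣1⇒≡1 2∣1
  ... | ()
  odd-power {p} 2∤p (suc n) 2∣pⁿ⁺¹ with euclidsLemma p (p ℕ.^ n) prime[2] 2∣pⁿ⁺¹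
  ... | inj₁ 2∣p  = 2∤p 2∣p
  ... | inj₂ 2∣pⁿ = odd-power 2∤p n 2∣pⁿ

module FiniteField {c ℓ} (K : Field c ℓ) {q : ℕ} (card : HasCardinality K q) where
  open Field K
  open FieldOps K using (fromℕ)
  open Parity
  open import Data.Nat.Divisibility using (_∣_)
  open import Data.Fin as Fin using (Fin)
  open import Data.Product using (_,_; proj₁; proj₂)
  open import Relation.Binary.PropositionalEquality using (_≢_)
  open import Relation.Binary.Reasoning.Setoid setoid

  element : Fin q → Carrier
  element = proj₁ card

  element-injective : ∀ i j → element i ≈ element j → i ≡ j
  element-injective = proj₁ (proj₂ card)

  index : Carrier → Fin q
  index x = proj₁ (proj₂ (proj₂ card) x)

  element-index : ∀ x → element (index x) ≈ x
  element-index x = proj₂ (proj₂ (proj₂ card) x)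

  _≟_ : ∀ x y → Dec (x ≈ y)
  x ≟ y with index x Fin.≟ index y
  ... | yes i≡j = yes (trans (sym (element-index x)) (trans (reflexive (≡.cong element i≡j)) (element-index y)))
  ... | no  i≢j = no (λ x≈y → i≢j (element-injective _ _
                      (trans (element-index x) (trans x≈y (sym (element-index y))))))

  -- In characteristic 2, x ↦ x + 1 is a fixed-point-free involution, so q is even.
  characteristic-2⇒even : fromℕ 2 ≈ 0# → 2 ∣ q
  characteristic-2⇒even 2≈0 = involution⇒even q shift shift∘shift≡id shift-fixed-free
    where
    shift : Fin q → Fin q
    shift i = index (element i + 1#)

    shift∘shift≡id : ∀ i → shift (shift i) ≡ i
    shift∘shift≡id i = element-injective _ _ (begin
      element (shift (shift i))   ≈⟨ element-index _ ⟩
      element (shift i) + 1#      ≈⟨ +-congʳ (element-index _) ⟩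
      element i + 1# + 1#         ≈⟨ +-assoc _ _ _ ⟩
      element i + (1# + 1#)       ≈⟨ +-congˡ (trans (+-congˡ (sym (+-identityʳ 1#))) 2≈0) ⟩
      element i + 0#              ≈⟨ +-identityʳ _ ⟩
      element i                   ∎)

    shift-fixed-free : ∀ i → shift i ≢ i
    shift-fixed-free i shift-i≡i = 1≉0 (begin
      1#                               ≈⟨ +-identityˡ 1# ⟨
      0# + 1#                          ≈⟨ +-congʳ (-‿inverseˡ (element i)) ⟨
      - element i + element i + 1#     ≈⟨ +-assoc _ _ _ ⟩
      - element i + (element i + 1#)   ≈⟨ +-congˡ (trans (sym (element-index _)) (reflexive (≡.cong element shift-i≡i))) ⟩
      - element i + element i          ≈⟨ -‿inverseˡ (element i) ⟩
      0#                               ∎)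

  2≉0 : IsPowerOfOddPrime q → ¬ (fromℕ 2 ≈ 0#)
  2≉0 (p , n , _ , 2∤p , _ , q≡pⁿ) 2≈0 = odd-power 2∤p n (≡.subst (2 ∣_) q≡pⁿ (characteristic-2⇒even 2≈0))

F-degree : ∀ {c ℓ} (K : Field c ℓ) A B i j → 3 < i +ℕ j → CurveF.F K A B i j ≡ Field.0# K
F-degree K A B 0 _ (s≤s (s≤s (s≤s (s≤s _)))) = ≡.refl
F-degree K A B 1 _ (s≤s (s≤s (s≤s (s≤s _)))) = ≡.refl
F-degree K A B 2 _ (s≤s (s≤s (s≤s (s≤s _)))) = ≡.refl
F-degree K A B 3 _ (s≤s (s≤s (s≤s (s≤s _)))) = ≡.refl
F-degree K A B (suc (suc (suc (suc _)))) _ _ = ≡.refl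

proposition2p1 : ∀ {c ℓ c′ ℓ′ : Level}
    (q : ℕ) → IsPowerOfOddPrime q →
    (K : Field c ℓ) → HasCardinality K q →
    (A B : Field.Carrier K) →
    ¬ (Field._≈_ K A (Field.0# K)) → ¬ (Field._≈_ K B (Field.0# K)) →
    (L : Field c′ ℓ′) (ι : Field.Carrier K → Field.Carrier L) →
    IsAlgebraicClosure K L ι →
    (a b : Field.Carrier L) →
    Bivariate.LineDivides L a b (λ i j → ι (CurveF.F K A B i j)) →
    Conclusion.Concl K A B
-- (a) the line lies on F_C for C = ι c(A,B); (b) so the criterion holds for
-- ι c(A,B), classically; (c) it descends to c(A,B) and is decidable there;
-- (d) it yields (1)-(5).
proposition2p1 q odd-q K card A B A≉0 B≉0 L ι closure a b line-divides =
  criterion⇒conclusion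
    (decidable-stable (SymmetricCubic.criterion? K _≟_ (c₀ A B) (c₁ A B) (c₂ A B) (c₃ A B))
      (¬¬-map (criterion-descends _≟_)
        (SymmetricCubic.line-criterion L ιc₀≉0 line-on-F)))
  where
  open FiniteField K card using (_≟_; 2≉0)
  open CurveF K using (F; c₀; c₁; c₂; c₃)
  open TheFamily K _≟_ (2≉0 odd-q) A≉0 B≉0 using (criterion⇒conclusion)
  open FieldLemmas K using (*-nonzero)
  open LinesOnCubics L using (LineOn; divides⇒LineOn)
  module L = Field L

  hom : RingMorphisms.IsRingHomomorphism (Field.rawRing K) (Field.rawRing L) ι
  hom = IsAlgebraicClosure.isRingHomomorphism closure
  open FieldHomomorphism K L ι hom using (nonzero-preserved; criterion-descends)

  ιc₀≉0 : ¬ (ι (c₀ A B) L.≈ L.0#)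
  ιc₀≉0 = nonzero-preserved (*-nonzero (*-nonzero (2≉0 odd-q) A≉0) B≉0)

  F-cubic : ∀ i j → 3 < i +ℕ j → ι (F A B i j) L.≈ L.0#
  F-cubic i j 3<i+j = L.trans (L.reflexive (≡.cong ι (F-degree K A B i j 3<i+j)))
                              (RingMorphisms.IsRingHomomorphism.0#-homo hom)

  -- The line lies on ι(F_{A,B}), which is F_C for C = ι(c(A,B)).
  line-on-F : SymmetricCubic.OnF L {ι (c₀ A B)} {ι (c₁ A B)} {ι (c₂ A B)} {ι (c₃ A B)} a b
  line-on-F = record { coeff₃ = coeff₃ line ; coeff₂ = coeff₂ line ; coeff₁ = coeff₁ line ; coeff₀ = coeff₀ line }
    where
    open LineOn
    line : LineOn (λ i j → ι (F A B i j)) a b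
    line = divides⇒LineOn line-divides F-cubic
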